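{- Let $X\subseteq\mathbb{N}$ and $n\ge1$, and let $X^*\subseteq[n]$ be defined by $i\in X^*\iff n+1-i\in X\cap[n]$. Then for every $s\ge0$, $Q_{n,s}^X=P_{n,s}^{X^*}$.
   Context: $S_n$ is the set of permutations $\sigma=\sigma_1\cdots\sigma_n$ of $[n]$. For $X\subseteq\mathbb{N}$, $P_{n,s}^X$ is the number of $\sigma\in S_n$ with exactly $s$ indices $i$ such that $\sigma_i>\sigma_{i+1}$ and $\sigma_i\in X$ (descents with top in $X$), and $Q_{n,s}^X$ is the number of $\sigma\in S_n$ with exactly $s$ indices $i$ such that $\sigma_i>\sigma_{i+1}$ and $\sigma_{i+1}\in X$ (descents with bottom in $X$). -}

module Defs where

open import Data.Nat using (ℕ; zero; suc; _+_; _∸_; _<ᵇ_; _≤ᵇ_; _≟_)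
open import Data.Bool using (Bool; true; false; if_then_else_; _∧_)
open import Data.List using (List; []; _∷_; map; concatMap; upTo; filter; length)
import Data.List.Relation.Unary.Unique.DecPropositional as UniqueDec

Subsetℕ : Set
Subsetℕ = ℕ → Bool

range : ℕ → List ℕ
range n = map suc (upTo n)

words : ℕ → ℕ → List (List ℕ)
words zero    n = [] ∷ []
words (suc k) n = concatMap (λ a → map (a ∷_) (words k n)) (range n)

-- S n : all permutations σ = σ₁⋯σₙ of [n], as words of length n over [n]
-- with pairwise distinct letters.
S : ℕ → List (List ℕ)
S n = filter (UniqueDec.unique? _≟_) (words n n)

desTop : Subsetℕ → List ℕ → ℕ
desTop X []            = 0
desTop X (a ∷ [])      = 0
desTop X (a ∷ b ∷ σ)   =
  (if (b <ᵇ a) ∧ X a then 1 else 0) + desTop X (b ∷ σ)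

desBot : Subsetℕ → List ℕ → ℕ
desBot X []            = 0
desBot X (a ∷ [])      = 0
desBot X (a ∷ b ∷ σ)   =
  (if (b <ᵇ a) ∧ X b then 1 else 0) + desBot X (b ∷ σ)

P : Subsetℕ → ℕ → ℕ → ℕ
P X n s = length (filter (λ σ → desTop X σ ≟ s) (S n))

Q : Subsetℕ → ℕ → ℕ → ℕ
Q X n s = length (filter (λ σ → desBot X σ ≟ s) (S n))

star : ℕ → Subsetℕ → Subsetℕ
star n X i = (1 ≤ᵇ i) ∧ (i ≤ᵇ n) ∧ X (suc n ∸ i)

-- The reverse-complement σ ↦ (n+1−σₙ)⋯(n+1−σ₁) is an involution of Sₙ. Reading
-- σ backwards and complementing, a descent σᵢ > σᵢ₊₁ becomes the adjacent pair
-- (n+1−σᵢ₊₁, n+1−σᵢ), again a descent since complementation reverses the order,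
-- and its top n+1−σᵢ₊₁ lies in X* exactly when its bottom σᵢ₊₁ lies in X. So the
-- involution carries the descent-bottom statistic for X to the descent-top
-- statistic for X*, and the two level sets are equinumerous.
module Submission where

open import Defs
open import Data.Bool using (Bool; T; _∧_; if_then_else_)
open import Data.Bool.Properties using (T-≡)
open import Data.List
  using (List; []; _∷_; _++_; map; concatMap; filter; length; reverse; cartesianProductWith)
open import Data.List.Properties
  using (∷-injective; filter-accept; filter-reject; ++-assoc; unfold-reverse; reverse-map; reverse-involutive; length-map; length-reverse)
open import Data.List.Membership.Propositional using (_∈_)
open import Data.List.Membership.Propositional.Properties
  using (∈-map⁺; ∈-map⁻; ∈-upTo⁺; ∈-upTo⁻; ∈-filter⁺; ∈-filter⁻;
         ∈-cartesianProductWith⁺; ∈-cartesianProductWith⁻)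
open import Data.List.Membership.Propositional.Properties.WithK using (unique∧set⇒bag)
open import Data.List.Relation.Binary.BagAndSetEquality using (∼bag⇒↭)
open import Data.List.Relation.Binary.Permutation.Propositional using (_↭_)
open import Data.List.Relation.Binary.Permutation.Propositional.Properties
  using (↭-length; filter-↭; ↭-reverse; ∈-resp-↭)
import Data.List.Relation.Binary.Permutation.Setoid as Setoid↭
import Data.List.Relation.Binary.Permutation.Setoid.Properties as Setoid↭ₚ
open import Data.List.Relation.Unary.All as All using (All; []; _∷_)
open import Data.List.Relation.Unary.Any using (here; there)
import Data.List.Relation.Unary.All.Properties as All
open import Data.List.Relation.Unary.Unique.Propositional using (Unique; []; _∷_)
import Data.List.Relation.Unary.Unique.Propositional.Properties as Unique
import Data.List.Relation.Unary.Unique.DecPropositional as UniqueDec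
open import Data.Nat using (ℕ; zero; suc; _+_; _∸_; _<ᵇ_; _≟_; _≤_; _<_; _≥_; z≤n; s≤s)
open import Data.Nat.Properties
open import Data.Product using (_×_; _,_; proj₁; proj₂)
open import Function.Bundles using (mk⇔; Equivalence)
open import Relation.Binary.PropositionalEquality
  using (_≡_; refl; sym; trans; cong; cong₂; setoid; module ≡-Reasoning)
open import Relation.Nullary using (yes; no)
open import Relation.Nullary.Reflects using (det; fromEquivalence)

indicator : Bool → ℕ
indicator b = if b then 1 else 0

Unique-map⁺ : {A B : Set} (f : A → B) {xs : List A} →
  (∀ {x y} → x ∈ xs → y ∈ xs → f x ≡ f y → x ≡ y) → Unique xs → Unique (map f xs)
Unique-map⁺ f {[]} inj [] = []
Unique-map⁺ f {x ∷ xs} inj (x∉xs ∷ u) =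
  All.map⁺ (All.tabulate (λ y∈xs fx≡fy → All.lookup x∉xs y∈xs (inj (here refl) (there y∈xs) fx≡fy)))
  ∷ Unique-map⁺ f (λ x∈ y∈ → inj (there x∈) (there y∈)) u

Unique-reverse : {A : Set} {xs : List A} → Unique xs → Unique (reverse xs)
Unique-reverse {A} {xs} =
  Setoid↭ₚ.Unique-resp-↭ (setoid A) (Setoid↭.↭-sym (setoid A) (Setoid↭ₚ.↭-reverse (setoid A) xs))

map-involution-↭ : {A : Set} (f : A → A) {xs : List A} → Unique xs →
  (∀ {x} → x ∈ xs → f x ∈ xs) → (∀ {x} → x ∈ xs → f (f x) ≡ x) → map f xs ↭ xs
map-involution-↭ f {xs} u closed involutive =
  ∼bag⇒↭ (unique∧set⇒bag (Unique-map⁺ f injective u) u (mk⇔ to from))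
  where
  injective : ∀ {x y} → x ∈ xs → y ∈ xs → f x ≡ f y → x ≡ y
  injective x∈ y∈ fx≡fy = trans (sym (involutive x∈)) (trans (cong f fx≡fy) (involutive y∈))
  to : ∀ {y} → y ∈ map f xs → y ∈ xs
  to y∈ with ∈-map⁻ f y∈
  ... | x , x∈ , refl = closed x∈
  from : ∀ {y} → y ∈ xs → y ∈ map f xs
  from {y} y∈ with ∈-map⁺ f (closed y∈)
  ... | ffy∈ rewrite involutive y∈ = ffy∈

filter-map-level : {A B : Set} (f : A → B) (g : B → ℕ) (h : A → ℕ) (s : ℕ) {xs : List A} →
  All (λ x → g (f x) ≡ h x) xs →
  filter (λ y → g y ≟ s) (map f xs) ≡ map f (filter (λ x → h x ≟ s) xs)
filter-map-level f g h s [] = refl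
filter-map-level f g h s {x ∷ xs} (gfx≡hx ∷ rest) with h x ≟ s
... | yes hx≡s = begin
  filter (λ y → g y ≟ s) (f x ∷ map f xs)    ≡⟨ filter-accept (λ y → g y ≟ s) (trans gfx≡hx hx≡s) ⟩
  f x ∷ filter (λ y → g y ≟ s) (map f xs)    ≡⟨ cong (f x ∷_) (filter-map-level f g h s rest) ⟩
  map f (x ∷ filter (λ x → h x ≟ s) xs)      ≡⟨ cong (map f) (filter-accept (λ x → h x ≟ s) hx≡s) ⟨
  map f (filter (λ x → h x ≟ s) (x ∷ xs))    ∎
  where open ≡-Reasoning
... | no hx≢s = begin
  filter (λ y → g y ≟ s) (f x ∷ map f xs)    ≡⟨ filter-reject (λ y → g y ≟ s) (λ gfx≡s → hx≢s (trans (sym gfx≡hx) gfx≡s)) ⟩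
  filter (λ y → g y ≟ s) (map f xs)          ≡⟨ filter-map-level f g h s rest ⟩
  map f (filter (λ x → h x ≟ s) xs)          ≡⟨ cong (map f) (filter-reject (λ x → h x ≟ s) hx≢s) ⟨
  map f (filter (λ x → h x ≟ s) (x ∷ xs))    ∎
  where open ≡-Reasoning

concatMap-map≡cartesianProductWith : {A B C : Set} (f : A → B → C) (xs : List A) (ys : List B) →
  concatMap (λ x → map (f x) ys) xs ≡ cartesianProductWith f xs ys
concatMap-map≡cartesianProductWith f [] ys = refl
concatMap-map≡cartesianProductWith f (x ∷ xs) ys =
  cong (map (f x) ys ++_) (concatMap-map≡cartesianProductWith f xs ys)

∈-range⁺ : ∀ {n x} → 1 ≤ x → x ≤ n → x ∈ range n
∈-range⁺ {x = suc x} _ x≤n = ∈-map⁺ suc (∈-upTo⁺ x≤n)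

∈-range⁻ : ∀ {n x} → x ∈ range n → 1 ≤ x × x ≤ n
∈-range⁻ x∈ with ∈-map⁻ suc x∈
... | x , x∈upTo , refl = s≤s z≤n , ∈-upTo⁻ x∈upTo

∈-range⇒≤1+n : ∀ {n x} → x ∈ range n → x ≤ suc n
∈-range⇒≤1+n x∈ = m≤n⇒m≤1+n (proj₂ (∈-range⁻ x∈))

Unique-range : ∀ n → Unique (range n)
Unique-range n = Unique.map⁺ suc-injective (Unique.upTo⁺ n)

complement : ℕ → ℕ → ℕ
complement n x = suc n ∸ x

complement-involutive : ∀ {n x} → x ≤ suc n → complement n (complement n x) ≡ x
complement-involutive = m∸[m∸n]≡n

complement-∈-range : ∀ {n x} → x ∈ range n → complement n x ∈ range n
complement-∈-range {n} x∈ with ∈-range⁻ x∈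
... | 1≤x , x≤n = ∈-range⁺ (m<n⇒0<n∸m (s≤s x≤n)) (∸-monoʳ-≤ (suc n) 1≤x)

complement-<ᵇ : ∀ {n a} b → a ≤ suc n → (complement n a <ᵇ complement n b) ≡ (b <ᵇ a)
complement-<ᵇ {n} {a} b a≤1+n =
  det (<ᵇ-reflects-< (complement n a) (complement n b)) (fromEquivalence reversed reflected)
  where
  reversed : T (b <ᵇ a) → complement n a < complement n b
  reversed b<ᵇa = ∸-monoʳ-< (<ᵇ⇒< b a b<ᵇa) a≤1+n
  reflected : complement n a < complement n b → T (b <ᵇ a)
  reflected c<c = <⇒<ᵇ {b} {a} (≰⇒> (λ a≤b → <⇒≱ c<c (∸-monoʳ-≤ (suc n) a≤b)))

star-complement : ∀ {n} X {b} → b ∈ range n → star n X (complement n b) ≡ X b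
star-complement {n} X {b} b∈ with ∈-range⁻ (complement-∈-range b∈)
... | 1≤c , c≤n
  rewrite Equivalence.to T-≡ (≤⇒≤ᵇ 1≤c) | Equivalence.to T-≡ (≤⇒≤ᵇ c≤n)
        | complement-involutive {n} (∈-range⇒≤1+n b∈) = refl

words-suc : ∀ k n → words (suc k) n ≡ cartesianProductWith _∷_ (range n) (words k n)
words-suc k n = concatMap-map≡cartesianProductWith _∷_ (range n) (words k n)

∈-words⁺ : ∀ {k n w} → length w ≡ k → All (_∈ range n) w → w ∈ words k n
∈-words⁺ {zero} {w = []} refl [] = here refl
∈-words⁺ {suc k} {n} {a ∷ w} |w|≡1+k (a∈ ∷ w⊆) rewrite words-suc k n =
  ∈-cartesianProductWith⁺ _∷_ a∈ (∈-words⁺ (suc-injective |w|≡1+k) w⊆)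

∈-words⁻ : ∀ {k n w} → w ∈ words k n → length w ≡ k × All (_∈ range n) w
∈-words⁻ {zero} (here refl) = refl , []
∈-words⁻ {suc k} {n} w∈ rewrite words-suc k n
  with ∈-cartesianProductWith⁻ _∷_ (range n) (words k n) w∈
... | a , w , a∈ , w∈ , refl with ∈-words⁻ w∈
... | |w|≡k , w⊆ = cong suc |w|≡k , a∈ ∷ w⊆

Unique-words : ∀ k n → Unique (words k n)
Unique-words zero n = [] ∷ []
Unique-words (suc k) n rewrite words-suc k n =
  Unique.cartesianProductWith⁺ _∷_ ∷-injective (Unique-range n) (Unique-words k n)

Unique-S : ∀ n → Unique (S n)
Unique-S n = Unique.filter⁺ (UniqueDec.unique? _≟_) (Unique-words n n)

∈-S⁺ : ∀ {n σ} → length σ ≡ n → All (_∈ range n) σ → Unique σ → σ ∈ S n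
∈-S⁺ |σ|≡n σ⊆ u = ∈-filter⁺ (UniqueDec.unique? _≟_) (∈-words⁺ |σ|≡n σ⊆) u

∈-S⁻ : ∀ {n σ} → σ ∈ S n → length σ ≡ n × All (_∈ range n) σ × Unique σ
∈-S⁻ {n} σ∈ with ∈-filter⁻ (UniqueDec.unique? _≟_) {xs = words n n} σ∈
... | σ∈words , u with ∈-words⁻ σ∈words
... | |σ|≡n , σ⊆ = |σ|≡n , σ⊆ , u

reverseComplement : ℕ → List ℕ → List ℕ
reverseComplement n σ = reverse (map (complement n) σ)

reverseComplement-∷ : ∀ n a σ → reverseComplement n (a ∷ σ) ≡ reverseComplement n σ ++ complement n a ∷ []
reverseComplement-∷ n a σ = unfold-reverse (complement n a) (map (complement n) σ)

map-complement-involutive : ∀ {n σ} → All (_∈ range n) σ → map (complement n) (map (complement n) σ) ≡ σ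
map-complement-involutive [] = refl
map-complement-involutive (a∈ ∷ σ⊆) =
  cong₂ _∷_ (complement-involutive (∈-range⇒≤1+n a∈)) (map-complement-involutive σ⊆)

reverseComplement-involutive : ∀ {n σ} → All (_∈ range n) σ → reverseComplement n (reverseComplement n σ) ≡ σ
reverseComplement-involutive {n} {σ} σ⊆ = begin
  reverse (map (complement n) (reverse (map (complement n) σ)))  ≡⟨ cong reverse (reverse-map (complement n) (map (complement n) σ)) ⟩
  reverse (reverse (map (complement n) (map (complement n) σ)))  ≡⟨ reverse-involutive _ ⟩
  map (complement n) (map (complement n) σ)                      ≡⟨ map-complement-involutive σ⊆ ⟩
  σ                                                              ∎
  where open ≡-Reasoning

reverseComplement-∈-S : ∀ {n σ} → σ ∈ S n → reverseComplement n σ ∈ S n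
reverseComplement-∈-S {n} {σ} σ∈ with ∈-S⁻ σ∈
... | |σ|≡n , σ⊆ , u = ∈-S⁺ length-rc rc⊆ (Unique-reverse (Unique-map⁺ (complement n) injective u))
  where
  length-rc : length (reverseComplement n σ) ≡ n
  length-rc = trans (length-reverse (map (complement n) σ)) (trans (length-map (complement n) σ) |σ|≡n)
  rc⊆ : All (_∈ range n) (reverseComplement n σ)
  rc⊆ = All.tabulate λ x∈ → All.lookup (All.map⁺ {P = _∈ range n} (All.map complement-∈-range σ⊆))
                                        (∈-resp-↭ (↭-reverse (map (complement n) σ)) x∈)
  injective : ∀ {x y} → x ∈ σ → y ∈ σ → complement n x ≡ complement n y → x ≡ y
  injective x∈ y∈ = ∸-cancelˡ-≡ (∈-range⇒≤1+n (All.lookup σ⊆ x∈)) (∈-range⇒≤1+n (All.lookup σ⊆ y∈))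

map-reverseComplement-↭ : ∀ n → map (reverseComplement n) (S n) ↭ S n
map-reverseComplement-↭ n = map-involution-↭ (reverseComplement n) (Unique-S n) reverseComplement-∈-S
  (λ σ∈ → reverseComplement-involutive (proj₁ (proj₂ (∈-S⁻ σ∈))))

desTop-∷ʳ : ∀ Y xs a b →
  desTop Y (xs ++ a ∷ b ∷ []) ≡ desTop Y (xs ++ a ∷ []) + indicator ((b <ᵇ a) ∧ Y a)
desTop-∷ʳ Y [] a b = +-identityʳ _
desTop-∷ʳ Y (x ∷ []) a b =
  trans (cong (top +_) (+-identityʳ new)) (cong (_+ new) (sym (+-identityʳ top)))
  where
  top new : ℕ
  top = indicator ((a <ᵇ x) ∧ Y x)
  new = indicator ((b <ᵇ a) ∧ Y a)
desTop-∷ʳ Y (x ∷ y ∷ xs) a b =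
  trans (cong (top +_) (desTop-∷ʳ Y (y ∷ xs) a b)) (sym (+-assoc top (desTop Y (y ∷ xs ++ a ∷ [])) _))
  where
  top : ℕ
  top = indicator ((y <ᵇ x) ∧ Y x)

desTop-reverseComplement : ∀ {n} X {σ} → All (_∈ range n) σ →
  desTop (star n X) (reverseComplement n σ) ≡ desBot X σ
desTop-reverseComplement X [] = refl
desTop-reverseComplement X (_ ∷ []) = refl
desTop-reverseComplement {n} X {a ∷ b ∷ σ} (a∈ ∷ b∈ ∷ σ⊆) = begin
  desTop Y (rc (a ∷ b ∷ σ))
    ≡⟨ cong (desTop Y) unfold-rc ⟩
  desTop Y (rc σ ++ complement n b ∷ complement n a ∷ [])
    ≡⟨ desTop-∷ʳ Y (rc σ) (complement n b) (complement n a) ⟩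
  desTop Y (rc σ ++ complement n b ∷ []) + indicator ((complement n a <ᵇ complement n b) ∧ Y (complement n b))
    ≡⟨ cong₂ _+_ (cong (desTop Y) (sym (reverseComplement-∷ n b σ)))
                 (cong₂ (λ u v → indicator (u ∧ v)) (complement-<ᵇ b a≤1+n) (star-complement X b∈)) ⟩
  desTop Y (rc (b ∷ σ)) + indicator ((b <ᵇ a) ∧ X b)
    ≡⟨ cong (_+ indicator ((b <ᵇ a) ∧ X b)) (desTop-reverseComplement X (b∈ ∷ σ⊆)) ⟩
  desBot X (b ∷ σ) + indicator ((b <ᵇ a) ∧ X b)
    ≡⟨ +-comm (desBot X (b ∷ σ)) _ ⟩
  desBot X (a ∷ b ∷ σ)
    ∎
  where
  open ≡-Reasoning
  Y : Subsetℕ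
  Y = star n X
  rc : List ℕ → List ℕ
  rc = reverseComplement n
  a≤1+n : a ≤ suc n
  a≤1+n = ∈-range⇒≤1+n a∈
  unfold-rc : rc (a ∷ b ∷ σ) ≡ rc σ ++ complement n b ∷ complement n a ∷ []
  unfold-rc = begin
    rc (a ∷ b ∷ σ)                                             ≡⟨ reverseComplement-∷ n a (b ∷ σ) ⟩
    rc (b ∷ σ) ++ complement n a ∷ []                          ≡⟨ cong (_++ complement n a ∷ []) (reverseComplement-∷ n b σ) ⟩
    (rc σ ++ complement n b ∷ []) ++ complement n a ∷ []       ≡⟨ ++-assoc (rc σ) (complement n b ∷ []) (complement n a ∷ []) ⟩
    rc σ ++ complement n b ∷ complement n a ∷ []               ∎

theorem2p9 : (X : Subsetℕ) (n : ℕ) → n ≥ 1 → (s : ℕ) →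
    Q X n s ≡ P (star n X) n s
theorem2p9 X n _ s = begin
  length (filter (λ σ → desBot X σ ≟ s) (S n))
    ≡⟨ length-map rc (filter (λ σ → desBot X σ ≟ s) (S n)) ⟨
  length (map rc (filter (λ σ → desBot X σ ≟ s) (S n)))
    ≡⟨ cong length (filter-map-level rc (desTop Y) (desBot X) s
                      (All.tabulate (λ σ∈ → desTop-reverseComplement X (proj₁ (proj₂ (∈-S⁻ σ∈)))))) ⟨
  length (filter (λ σ → desTop Y σ ≟ s) (map rc (S n)))
    ≡⟨ ↭-length (filter-↭ (λ σ → desTop Y σ ≟ s) (map-reverseComplement-↭ n)) ⟩
  length (filter (λ σ → desTop Y σ ≟ s) (S n))
    ∎
  where
  open ≡-Reasoning
  Y : Subsetℕ
  Y = star n X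
  rc : List ℕ → List ℕ
  rc = reverseComplement n
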